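{- (1) If a finite family $F$ is FC-covered by an FC-family $F_c$, then $F$ is an FC-family. (2) If a finite family $F$ is nonFC-covered by a nonFC-family $N_c$, then $F$ is not an FC-family.
   Context: All sets and families are finite. A family $F$ is union-closed if $A\cup B\in F$ for all $A,B\in F$. The closure $\mathrm{cl}(F)$ is the smallest union-closed family containing $F$ (equivalently, the set of unions $\bigcup G$ over nonempty $G\subseteq F$). $\mathrm{cnt}(a,F)=|\{A\in F:a\in A\}|$. A family $F_c$ is an FC-family if for every union-closed family $F\supseteq F_c$ there is $a\in\bigcup F_c$ with $2\cdot\mathrm{cnt}(a,F)\ge|F|$; otherwise it is a nonFC-family. Families $F,F'$ are isomorphic if there is a bijection $f:\bigcup F\to\bigcup F'$ with $\{f[B]:B\in F\}=F'$. $F$ is FC-covered by $F_c$ if there is a family $F_c'$ isomorphic to $F_c$ with $F_c'\subseteq\mathrm{cl}(F)$. $F$ is nonFC-covered by $N_c$ if there is a family $N_c'$ isomorphic to $N_c$ with $\mathrm{cl}(F)\subseteq\mathrm{cl}(N_c')\cup\{\emptyset\}$. -}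

module Defs where

open import Data.Nat using (ℕ; _*_; _≥_)
open import Data.Nat.Properties using (_≟_)
open import Data.List using (List; []; _∷_; _++_; concat; map; length; filter)
open import Data.List.Membership.Propositional using (_∈_)
open import Data.List.Membership.DecPropositional _≟_ using (_∈?_)
open import Data.List.Relation.Unary.Any using (Any)
open import Data.List.Relation.Unary.All using (All)
open import Data.List.Relation.Unary.AllPairs using (AllPairs)
open import Data.Product using (Σ; ∃; _×_; _,_)
open import Data.Sum using (_⊎_)
open import Relation.Nullary using (¬_)
open import Relation.Binary.PropositionalEquality using (_≡_; _≢_)
open import Function.Bundles using (_⇔_)

-- A finite set of elements (ground elements are natural numbers),
-- represented by a list; lists are compared extensionally.
FSet : Set
FSet = List ℕ

_≈ˢ_ : FSet → FSet → Set
A ≈ˢ B = ∀ x → (x ∈ A) ⇔ (x ∈ B)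

Family : Set
Family = List FSet

_∈F_ : FSet → Family → Set
A ∈F F = Any (λ B → A ≈ˢ B) F

_⊆F_ : Family → Family → Set
F ⊆F G = ∀ A → A ∈F F → A ∈F G

-- The list has no repeated sets, so that its length is the size of the family.
NoDupF : Family → Set
NoDupF F = AllPairs (λ A B → ¬ (A ≈ˢ B)) F

⋃ : Family → FSet
⋃ F = concat F

UnionClosed : Family → Set
UnionClosed F = ∀ A B → A ∈F F → B ∈F F → (A ++ B) ∈F F

-- cnt(a, F) = |{A ∈ F : a ∈ A}|  (meaningful for duplicate-free F).
cnt : ℕ → Family → ℕ
cnt a F = length (filter (a ∈?_) F)

IsFC : Family → Set
IsFC Fc = ∀ (F : Family) → NoDupF F → UnionClosed F → Fc ⊆F F →
          ∃ λ a → a ∈ ⋃ Fc × 2 * cnt a F ≥ length F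

_∈cl_ : FSet → Family → Set
C ∈cl F = Σ Family λ G → G ≢ [] × All (λ B → B ∈F F) G × C ≈ˢ ⋃ G

-- F and F' are isomorphic: a bijection f : ⋃F → ⋃F' (given with its inverse g,
-- both as functions ℕ → ℕ restricted to the respective unions) such that
-- {f[B] : B ∈ F} = F'.
Isomorphic : Family → Family → Set
Isomorphic F F' = Σ (ℕ → ℕ) λ f → Σ (ℕ → ℕ) λ g →
    (∀ x → x ∈ ⋃ F → f x ∈ ⋃ F' × g (f x) ≡ x)
  × (∀ y → y ∈ ⋃ F' → g y ∈ ⋃ F × f (g y) ≡ y)
  × (∀ B → B ∈F F → map f B ∈F F')
  × (∀ B' → B' ∈F F' → Σ FSet λ B → B ∈F F × map f B ≈ˢ B')

FCCovered : Family → Family → Set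
FCCovered F Fc = Σ Family λ Fc' → Isomorphic Fc Fc' × (∀ A → A ∈F Fc' → A ∈cl F)

NonFCCovered : Family → Family → Set
NonFCCovered F Nc = Σ Family λ Nc' → Isomorphic Nc Nc' ×
  (∀ C → C ∈cl F → C ∈cl Nc' ⊎ C ≈ˢ [])

-- Being FC is invariant under isomorphism: a union-closed family around one copy
-- is pulled back to one around the other along an injective map of all of ℕ
-- extending the inverse bijection (such families may use points outside ⋃ F).
-- (1) Every union-closed G ⊇ F contains cl(F), hence the copy of F_c, whose
-- frequent element lies in ⋃ cl(F) = ⋃ F.  (2) If F were FC and G ⊇ N_c' were
-- union-closed, then G ∪ {∅} is union-closed and contains F; adjoining ∅ changes
-- no count and does not shrink the family, and the frequent element of F lies in
-- a nonempty set of cl(F) ⊆ cl(N_c'), so N_c', and with it N_c, would be FC.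
module Submission where

open import Defs
open import Data.List using (List)
open import Data.Product using (_×_)
open import Relation.Nullary using (¬_)

open import Data.Nat using (ℕ; suc; _+_; _*_; _≤_; s≤s)
open import Data.Nat.Properties using (_≟_; ≤-trans; ≤-refl; n≤1+n; m≤m+n; +-cancelˡ-≡; <-irrefl)
open import Data.List using ([]; _∷_; _++_; map; length)
open import Data.List.Properties using (≡-dec; length-map; ++-identityʳ; map-++; concat-map; map-∘; map-id-local)
open import Data.List.Extrema.Nat using (max; xs≤max)
open import Data.List.Membership.Propositional using (_∈_; find; lose)
open import Data.List.Membership.Propositional.Properties using (∈-map⁺; ∈-map⁻; ∈-concat⁺′; ∈-concat⁻′)
open import Data.List.Membership.DecPropositional _≟_ using (_∈?_)
open import Data.List.Relation.Binary.Subset.Propositional using (_⊆_)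
open import Data.List.Relation.Binary.BagAndSetEquality using (set; ++-cong; empty-unique)
open import Data.List.Relation.Unary.Any as Any using (here; there)
import Data.List.Relation.Unary.Any.Properties as Any
open import Data.List.Relation.Unary.All as All using (All; []; _∷_)
open import Data.List.Relation.Unary.All.Properties using (¬Any⇒All¬)
import Data.List.Relation.Unary.AllPairs as AllPairs
import Data.List.Relation.Unary.AllPairs.Properties as AllPairs
open import Data.Product using (Σ; ∃; _,_; proj₂; map₁; map₂)
open import Data.Sum using (inj₁; inj₂)
open import Data.Empty using (⊥-elim)
open import Function using (_∘_; id)
open import Function.Bundles using (Equivalence; mk⇔)
open import Function.Definitions using (Injective)
import Function.Properties.Equivalence as ⇔
open import Relation.Nullary using (Dec; yes; no)
open import Relation.Binary.PropositionalEquality using (_≡_; _≢_; refl; sym; trans; cong; subst; subst₂)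

open Equivalence using (to)

private
  variable
    x : ℕ
    A B C S T : FSet
    F F' G H : Family
    h : ℕ → ℕ

≈ˢ-refl : A ≈ˢ A
≈ˢ-refl _ = ⇔.refl

≈ˢ-sym : A ≈ˢ B → B ≈ˢ A
≈ˢ-sym A≈B x = ⇔.sym (A≈B x)

≈ˢ-trans : A ≈ˢ B → B ≈ˢ C → A ≈ˢ C
≈ˢ-trans A≈B B≈C x = ⇔.trans (A≈B x) (B≈C x)

≡⇒≈ˢ : A ≡ B → A ≈ˢ B
≡⇒≈ˢ refl = ≈ˢ-refl

++-congˢ : A ≈ˢ S → B ≈ˢ T → (A ++ B) ≈ˢ (S ++ T)
++-congˢ A≈S B≈T x = ++-cong {k = set} (λ {y} → A≈S y) (λ {y} → B≈T y)

≈ˢ[]⇒≡[] : A ≈ˢ [] → A ≡ []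
≈ˢ[]⇒≡[] A≈[] = empty-unique {k = set} (λ {y} → A≈[] y)

∈F-resp-≈ˢ : A ≈ˢ B → B ∈F G → A ∈F G
∈F-resp-≈ˢ A≈B = Any.map (≈ˢ-trans A≈B)

∈⇒∈F : A ∈ G → A ∈F G
∈⇒∈F A∈G = lose A∈G ≈ˢ-refl

All⇒⊆F : All (_∈F G) H → H ⊆F G
All⇒⊆F H⊆G A A∈H with find A∈H
... | B , B∈H , A≈B = ∈F-resp-≈ˢ A≈B (All.lookup H⊆G B∈H)

map-left-inverse : ∀ {f g : ℕ → ℕ} → (∀ {x} → x ∈ S → g (f x) ≡ x) → map g (map f S) ≡ S
map-left-inverse {S} g∘f≡id = trans (sym (map-∘ S)) (map-id-local (All.tabulate g∘f≡id))

∈-⋃ : x ∈ S → S ∈F F → x ∈ ⋃ F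
∈-⋃ {x} x∈S S∈F with find S∈F
... | B , B∈F , S≈B = ∈-concat⁺′ (to (S≈B x) x∈S) B∈F

⋃-mono : F ⊆F G → ⋃ F ⊆ ⋃ G
⋃-mono {F} F⊆G x∈⋃F with ∈-concat⁻′ F x∈⋃F
... | S , x∈S , S∈F = ∈-⋃ x∈S (F⊆G S (∈⇒∈F S∈F))

⋃-∈F : UnionClosed G → H ≢ [] → All (_∈F G) H → ⋃ H ∈F G
⋃-∈F closed H≢[] [] = ⊥-elim (H≢[] refl)
⋃-∈F closed _ (_∷_ {A} A∈G []) = subst (_∈F _) (sym (++-identityʳ A)) A∈G
⋃-∈F closed _ (_∷_ {A} A∈G (B∈G ∷ H⊆G)) = closed A _ A∈G (⋃-∈F closed (λ ()) (B∈G ∷ H⊆G))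

∈cl⇒∈F : UnionClosed G → F ⊆F G → C ∈cl F → C ∈F G
∈cl⇒∈F closed F⊆G (H , H≢[] , H⊆F , C≈⋃H) =
  ∈F-resp-≈ˢ C≈⋃H (⋃-∈F closed H≢[] (All.map (F⊆G _) H⊆F))

∈F⇒∈cl : A ∈F F → A ∈cl F
∈F⇒∈cl {A} A∈F = A ∷ [] , (λ ()) , A∈F ∷ [] , ≡⇒≈ˢ (sym (++-identityʳ A))

∈cl⇒⊆⋃ : C ∈cl F → C ⊆ ⋃ F
∈cl⇒⊆⋃ {C} (H , _ , H⊆F , C≈⋃H) {x} x∈C = ⋃-mono (All⇒⊆F H⊆F) (to (C≈⋃H x) x∈C)

image : (ℕ → ℕ) → Family → Family
image h = map (map h)

∈F-image⁻ : S ∈F image h G → ∃ λ C → C ∈ G × S ≈ˢ map h C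
∈F-image⁻ = find ∘ Any.map⁻

map-congˢ : (h : ℕ → ℕ) → S ≈ˢ T → map h S ≈ˢ map h T
map-congˢ h S≈T x = mk⇔ (transfer S≈T) (transfer (≈ˢ-sym S≈T))
  where
  transfer : ∀ {S T} → S ≈ˢ T → x ∈ map h S → x ∈ map h T
  transfer S≈T x∈hS with ∈-map⁻ h x∈hS
  ... | y , y∈S , refl = ∈-map⁺ h (to (S≈T y) y∈S)

∈F-image⁺ : S ∈F G → map h S ∈F image h G
∈F-image⁺ {h = h} = Any.map⁺ ∘ Any.map (map-congˢ h)

image-mono : F ⊆F G → image h F ⊆F image h G
image-mono F⊆G S S∈hF with ∈F-image⁻ S∈hF
... | C , C∈F , S≈hC = ∈F-resp-≈ˢ S≈hC (∈F-image⁺ (F⊆G C (∈⇒∈F C∈F)))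

image-UnionClosed : UnionClosed G → UnionClosed (image h G)
image-UnionClosed {h = h} closed S T S∈hG T∈hG with ∈F-image⁻ S∈hG | ∈F-image⁻ T∈hG
... | C , C∈G , S≈hC | D , D∈G , T≈hD =
  ∈F-resp-≈ˢ (≈ˢ-trans (++-congˢ S≈hC T≈hD) (≡⇒≈ˢ (sym (map-++ h C D))))
             (∈F-image⁺ (closed C D (∈⇒∈F C∈G) (∈⇒∈F D∈G)))

module _ (h-inj : Injective _≡_ _≡_ h) where

  ∈-map-injective : h x ∈ map h S → x ∈ S
  ∈-map-injective hx∈hS with ∈-map⁻ _ hx∈hS
  ... | y , y∈S , hx≡hy = subst (_∈ _) (sym (h-inj hx≡hy)) y∈S

  map-injective-≈ˢ : map h S ≈ˢ map h T → S ≈ˢ T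
  map-injective-≈ˢ hS≈hT x = mk⇔ (transfer hS≈hT) (transfer (≈ˢ-sym hS≈hT))
    where
    transfer : ∀ {S T} → map h S ≈ˢ map h T → x ∈ S → x ∈ T
    transfer hS≈hT = ∈-map-injective ∘ to (hS≈hT _) ∘ ∈-map⁺ h

  image-NoDupF : NoDupF G → NoDupF (image h G)
  image-NoDupF = AllPairs.map⁺ ∘ AllPairs.map (λ S≉T → S≉T ∘ map-injective-≈ˢ)

  cnt-image : ∀ x G → cnt (h x) (image h G) ≡ cnt x G
  cnt-image x [] = refl
  cnt-image x (C ∷ G) with h x ∈? map h C | x ∈? C
  ... | yes _     | yes _   = cong suc (cnt-image x G)
  ... | no _      | no _    = cnt-image x G
  ... | yes hx∈hC | no x∉C  = ⊥-elim (x∉C (∈-map-injective hx∈hC))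
  ... | no hx∉hC  | yes x∈C = ⊥-elim (hx∉hC (∈-map⁺ h x∈C))

  IsFC-preimage : F ⊆F image h F' → IsFC F → IsFC F'
  IsFC-preimage {F' = F'} F⊆hF' fc G noDup closed F'⊆G
    with fc (image h G) (image-NoDupF noDup) (image-UnionClosed closed) (λ S → image-mono F'⊆G S ∘ F⊆hF' S)
  ... | a , a∈⋃F , frequent
    with ∈-map⁻ h (subst (a ∈_) (concat-map F') (⋃-mono F⊆hF' a∈⋃F))
  ... | b , b∈⋃F' , refl =
    b , b∈⋃F' , subst₂ (λ c n → n ≤ 2 * c) (cnt-image b G) (length-map (map h) G) frequent

injective-extension : ∀ (X : List ℕ) (g : ℕ → ℕ) →
  (∀ {x y} → x ∈ X → y ∈ X → g x ≡ g y → x ≡ y) →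
  ∃ λ h → Injective _≡_ _≡_ h × (∀ {x} → x ∈ X → h x ≡ g x)
injective-extension X g g-inj = extension , extension-inj , extension-agrees
  where
  bound : ℕ
  bound = suc (max 0 (map g X))

  extend : ∀ x → Dec (x ∈ X) → ℕ
  extend x (yes _) = g x
  extend x (no _)  = bound + x

  extension : ℕ → ℕ
  extension x = extend x (x ∈? X)

  extension-agrees : ∀ {x} → x ∈ X → extension x ≡ g x
  extension-agrees {x} x∈X with x ∈? X
  ... | yes _   = refl
  ... | no x∉X = ⊥-elim (x∉X x∈X)

  g≢shift : ∀ {x} y → x ∈ X → g x ≢ bound + y
  g≢shift y x∈X gx≡ = <-irrefl gx≡
    (≤-trans (s≤s (All.lookup (xs≤max 0 (map g X)) (∈-map⁺ g x∈X))) (m≤m+n bound y))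

  extension-inj : Injective _≡_ _≡_ extension
  extension-inj {x} {y} hx≡hy with x ∈? X | y ∈? X
  ... | yes x∈X | yes y∈X = g-inj x∈X y∈X hx≡hy
  ... | yes x∈X | no _    = ⊥-elim (g≢shift y x∈X hx≡hy)
  ... | no _    | yes y∈X = ⊥-elim (g≢shift x y∈X (sym hx≡hy))
  ... | no _    | no _    = +-cancelˡ-≡ bound _ _ hx≡hy

Isomorphic-sym : Isomorphic F F' → Isomorphic F' F
Isomorphic-sym {F} {F'} (f , g , g∘f , f∘g , f[F]⊆F' , F'⊆f[F]) =
  g , f , f∘g , g∘f , g[F']⊆F , F⊆g[F']
  where
  g∘f≡id : S ∈F F → ∀ {x} → x ∈ S → g (f x) ≡ x
  g∘f≡id S∈F x∈S = proj₂ (g∘f _ (∈-⋃ x∈S S∈F))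

  g[F']⊆F : ∀ T → T ∈F F' → map g T ∈F F
  g[F']⊆F T T∈F' with F'⊆f[F] T T∈F'
  ... | S , S∈F , fS≈T =
    ∈F-resp-≈ˢ (≈ˢ-trans (map-congˢ g (≈ˢ-sym fS≈T)) (≡⇒≈ˢ (map-left-inverse (g∘f≡id S∈F)))) S∈F

  F⊆g[F'] : ∀ S → S ∈F F → Σ FSet λ T → T ∈F F' × map g T ≈ˢ S
  F⊆g[F'] S S∈F = map f S , f[F]⊆F' S S∈F , ≡⇒≈ˢ (map-left-inverse (g∘f≡id S∈F))

Isomorphic⇒⊆F-image : Isomorphic F F' → ∃ λ h → Injective _≡_ _≡_ h × F ⊆F image h F'
Isomorphic⇒⊆F-image {F} {F'} (f , g , g∘f , f∘g , f[F]⊆F' , _) =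
  map₂ (map₂ F⊆image) (injective-extension (⋃ F') g g-inj)
  where
  g-inj : ∀ {x y} → x ∈ ⋃ F' → y ∈ ⋃ F' → g x ≡ g y → x ≡ y
  g-inj {x} {y} x∈ y∈ gx≡gy =
    trans (sym (proj₂ (f∘g x x∈))) (trans (cong f gx≡gy) (proj₂ (f∘g y y∈)))

  F⊆image : (∀ {y} → y ∈ ⋃ F' → h y ≡ g y) → F ⊆F image h F'
  F⊆image {h} h≡g S S∈F = subst (_∈F image h F') (map-left-inverse h∘f≡id) (∈F-image⁺ (f[F]⊆F' S S∈F))
    where
    h∘f≡id : ∀ {x} → x ∈ S → h (f x) ≡ x
    h∘f≡id x∈S with g∘f _ (∈-⋃ x∈S S∈F)
    ... | fx∈⋃F' , gfx≡x = trans (h≡g fx∈⋃F') gfx≡x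

IsFC-resp-Isomorphic : Isomorphic F F' → IsFC F → IsFC F'
IsFC-resp-Isomorphic F≅F' with Isomorphic⇒⊆F-image F≅F'
... | h , h-inj , F⊆hF' = IsFC-preimage h-inj F⊆hF'

record ∅-Extension (G : Family) : Set where
  field
    family      : Family
    noDupF      : NoDupF family
    unionClosed : UnionClosed family
    ⊇G          : G ⊆F family
    ∅∈          : [] ∈F family
    length-≤    : length G ≤ length family
    cnt-≡       : ∀ a → cnt a family ≡ cnt a G

∅-extension : NoDupF G → UnionClosed G → ∅-Extension G
∅-extension {G} noDup closed with Any.any? (λ B → ≡-dec _≟_ B []) G
... | yes ∅∈G = record
  { family = G ; noDupF = noDup ; unionClosed = closed ; ⊇G = λ _ → id
  ; ∅∈ = Any.map (≈ˢ-sym ∘ ≡⇒≈ˢ) ∅∈G ; length-≤ = ≤-refl ; cnt-≡ = λ _ → refl }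
... | no ∅∉G = record
  { family = [] ∷ G ; noDupF = ∅≉G AllPairs.∷ noDup ; unionClosed = closed′
  ; ⊇G = λ _ → there ; ∅∈ = here ≈ˢ-refl ; length-≤ = n≤1+n _ ; cnt-≡ = λ _ → refl }
  where
  ∅≉G : All (λ B → ¬ ([] ≈ˢ B)) G
  ∅≉G = All.map (λ B≢[] []≈B → B≢[] (≈ˢ[]⇒≡[] (≈ˢ-sym []≈B))) (¬Any⇒All¬ G ∅∉G)

  closed′ : UnionClosed ([] ∷ G)
  closed′ S T (here S≈[]) T∈ rewrite ≈ˢ[]⇒≡[] S≈[] = T∈
  closed′ S T S∈ (here T≈[]) rewrite ≈ˢ[]⇒≡[] T≈[] | ++-identityʳ S = S∈
  closed′ S T (there S∈G) (there T∈G) = there (closed S T S∈G T∈G)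

⋃⊆⋃cl : (∀ A → A ∈F F' → A ∈cl F) → ⋃ F' ⊆ ⋃ F
⋃⊆⋃cl {F'} F'⊆clF x∈⋃F' with ∈-concat⁻′ F' x∈⋃F'
... | A , x∈A , A∈F' = ∈cl⇒⊆⋃ (F'⊆clF A (∈⇒∈F A∈F')) x∈A

FCCovered⇒IsFC : ∀ {F Fc} → IsFC Fc → FCCovered F Fc → IsFC F
FCCovered⇒IsFC fc (Fc' , Fc≅Fc' , Fc'⊆clF) G noDup closed F⊆G =
  map₂ (map₁ (⋃⊆⋃cl Fc'⊆clF))
       (IsFC-resp-Isomorphic Fc≅Fc' fc G noDup closed (λ A A∈Fc' → ∈cl⇒∈F closed F⊆G (Fc'⊆clF A A∈Fc')))

NonFCCovered⇒¬IsFC : ∀ {F Nc} → ¬ IsFC Nc → NonFCCovered F Nc → ¬ IsFC F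
NonFCCovered⇒¬IsFC {F} ¬fc (Nc' , Nc≅Nc' , clF⊆clNc'∪∅) fcF =
  ¬fc (IsFC-resp-Isomorphic (Isomorphic-sym Nc≅Nc') fcNc')
  where
  open ∅-Extension

  ⋃F⊆⋃Nc' : ⋃ F ⊆ ⋃ Nc'
  ⋃F⊆⋃Nc' a∈⋃F with ∈-concat⁻′ F a∈⋃F
  ... | A , a∈A , A∈F with clF⊆clNc'∪∅ A (∈F⇒∈cl (∈⇒∈F A∈F))
  ... | inj₁ A∈clNc' = ∈cl⇒⊆⋃ A∈clNc' a∈A
  ... | inj₂ A≈[]    = ⊥-elim (Any.¬Any[] (to (A≈[] _) a∈A))

  F⊆∅-extension : (G∅ : ∅-Extension G) → Nc' ⊆F G → F ⊆F family G∅
  F⊆∅-extension G∅ Nc'⊆G A A∈F with clF⊆clNc'∪∅ A (∈F⇒∈cl A∈F)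
  ... | inj₁ A∈clNc' = ∈cl⇒∈F (unionClosed G∅) (λ B → ⊇G G∅ B ∘ Nc'⊆G B) A∈clNc'
  ... | inj₂ A≈[]    = ∈F-resp-≈ˢ A≈[] (∅∈ G∅)

  fcNc' : IsFC Nc'
  fcNc' G noDup closed Nc'⊆G =
    let G∅ = ∅-extension noDup closed
        a , a∈⋃F , frequent = fcF (family G∅) (noDupF G∅) (unionClosed G∅) (F⊆∅-extension G∅ Nc'⊆G)
    in a , ⋃F⊆⋃Nc' a∈⋃F , ≤-trans (length-≤ G∅) (subst (λ c → _ ≤ 2 * c) (cnt-≡ G∅ a) frequent)

lemma2 : (∀ (F Fc : Family) → IsFC Fc → FCCovered F Fc → IsFC F)
       × (∀ (F Nc : Family) → ¬ IsFC Nc → NonFCCovered F Nc → ¬ IsFC F)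
lemma2 = (λ _ _ → FCCovered⇒IsFC) , (λ _ _ → NonFCCovered⇒¬IsFC)
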